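{- Let $l\geq2$ and let $H$ be a $(2l+2)$-modest hypergraph. Then no green vertex of $H$ is adjacent to two different red vertices.
   Context: A hypergraph is a pair $H=(U,T)$ with $U$ a finite nonempty vertex set and $T$ a collection of 3-element subsets of $U$ (hyperedges). For nonempty $X\subseteq U$, $\|X\|$ is its cardinality and $[X]$ is the number of hyperedges contained in $X$. $X$ is dense if $\|X\|\le2[X]$, super-dense if $\|X\|<2[X]$; a minimal dense set is a dense set with no proper nonempty dense subset. $H$ is $m$-modest if it has no super-dense vertex sets of cardinality $\le 2m$. Vertices $x,y$ are adjacent if some hyperedge contains both. With respect to the fixed $l$: a red block is a minimal dense vertex set of cardinality $\le2l$; a vertex is red if it belongs to a red block, and green otherwise. -}

module Defs where

open import Data.Nat using (ℕ; suc; _≤_; _<_; _*_; _+_)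
open import Data.Fin using (Fin)
open import Data.Fin.Subset using (Subset; _∈_; _⊆_; _⊂_; ∣_∣; Nonempty)
open import Data.Fin.Subset.Properties using (_⊆?_)
open import Data.List using (List; length; filter)
open import Data.List.Relation.Unary.All using (All)
open import Data.List.Relation.Unary.Any using (Any)
open import Data.List.Relation.Unary.Unique.Propositional using (Unique)
open import Data.Product using (_×_; ∃)
open import Relation.Binary.PropositionalEquality using (_≡_)
open import Relation.Nullary using (¬_)

-- A 3-uniform hypergraph on the nonempty vertex set U = Fin (suc n).
-- T is a (duplicate-free) list of 3-element subsets of U.
record Hypergraph (n : ℕ) : Set where
  field
    edges        : List (Subset (suc n))
    edges-unique : Unique edges
    edges-size   : All (λ e → ∣ e ∣ ≡ 3) edges
open Hypergraph public

module _ {n : ℕ} (H : Hypergraph n) where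

  ⟦_⟧ : Subset (suc n) → ℕ
  ⟦ X ⟧ = length (filter (_⊆? X) (edges H))

  Dense : Subset (suc n) → Set
  Dense X = Nonempty X × ∣ X ∣ ≤ 2 * ⟦ X ⟧

  SuperDense : Subset (suc n) → Set
  SuperDense X = Nonempty X × ∣ X ∣ < 2 * ⟦ X ⟧

  MinimalDense : Subset (suc n) → Set
  MinimalDense X = Dense X × (∀ Y → Y ⊂ X → Nonempty Y → ¬ Dense Y)

  Modest : ℕ → Set
  Modest m = ∀ X → ∣ X ∣ ≤ 2 * m → ¬ SuperDense X

  Adjacent : Fin (suc n) → Fin (suc n) → Set
  Adjacent x y = Any (λ e → x ∈ e × y ∈ e) (edges H)

  RedBlock : ℕ → Subset (suc n) → Set
  RedBlock l X = MinimalDense X × ∣ X ∣ ≤ 2 * l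

  Red : ℕ → Fin (suc n) → Set
  Red l x = ∃ λ X → RedBlock l X × x ∈ X

  Green : ℕ → Fin (suc n) → Set
  Green l x = ¬ Red l x

-- Let A ∋ r₁ and B ∋ r₂ be red blocks. Edge counts are supermodular and vertex counts
-- modular, while A ∩ B is too small to be super-dense, so D = A ∪ B is dense. A green g
-- lies outside D. If one edge contains g, r₁ and r₂, adding it to D adds one edge and at
-- most one vertex. Otherwise an edge e₁ ∋ g, r₁ and a different edge e₂ ∋ g, r₂ add two
-- edges and at most three vertices, since e₁ meets D and e₂ meets D ∪ e₁ in {g, r₂}.
-- Either way the result is super-dense of size at most 4l + 4, contradicting modesty.
module Submission where

open import Defs
open import Data.Bool using (true; false; _≟_)
open import Data.Empty using (⊥)
open import Data.Fin using (Fin)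
open import Data.Fin.Subset using (Subset; _∈_; _∉_; _⊆_; _∪_; _∩_; ∣_∣; inside; outside)
  renaming (⊥ to ∅)
open import Data.Fin.Subset.Properties
  using (_⊆?_; p⊆p∪q; q⊆p∪q; x∈p∪q⁻; x∈p∩q⁺; ⊆-trans; p⊆q⇒∣p∣≤∣q∣; x∈p⇒∣p-x∣<∣p∣; x∈p∧x≢y⇒x∈p-y;
         nonempty?; Empty-unique; ∣⊥∣≡0; ∣p∩q∣≤∣p∣)
open import Data.List using ([]; _∷_; length; filter)
open import Data.List.Properties using (filter-accept; filter-reject; filter-none)
open import Data.List.Membership.Propositional using (find) renaming (_∈_ to _∈ˡ_)
open import Data.List.Relation.Unary.Any using (here; there)
import Data.List.Relation.Unary.All as All
open import Data.Nat using (ℕ; suc; _≤_; _<_; _*_; _+_; z≤n; s≤s)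
open import Data.Nat.Properties
  using (≤-refl; ≤-reflexive; ≤-trans; n≤1+n; m≤m+n; m≤n*m; ≮⇒≥; +-suc; +-assoc; +-comm;
         +-mono-≤; +-monoˡ-≤; +-monoʳ-≤; +-monoʳ-<; +-cancelʳ-≤; *-distribˡ-+; *-monoʳ-≤;
         module ≤-Reasoning)
open import Data.Nat.Tactic.RingSolver using (solve-∀)
open import Data.Product using (_×_; _,_)
open import Data.Sum using ([_,_]′)
open import Data.Vec using ([]; _∷_)
open import Data.Vec.Properties using (≡-dec)
open import Function using (_∘_; _$_)
open import Relation.Binary.PropositionalEquality using (_≡_; _≢_; refl; sym; trans; cong; cong₂; subst₂)
open import Relation.Nullary using (¬_; yes; no; does; contradiction)
open import Relation.Unary using (Pred; Decidable)

module _ {a p} {A : Set a} {P : Pred A p} (P? : Decidable P) where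

  length-filter-accept : ∀ {x} xs → P x → length (filter P? (x ∷ xs)) ≡ suc (length (filter P? xs))
  length-filter-accept xs px = cong length (filter-accept P? px)

  length-filter-reject : ∀ {x} xs → ¬ P x → length (filter P? (x ∷ xs)) ≡ length (filter P? xs)
  length-filter-reject xs ¬px = cong length (filter-reject P? ¬px)

  length-filter-≤-∷ : ∀ x xs → length (filter P? xs) ≤ length (filter P? (x ∷ xs))
  length-filter-≤-∷ x xs with does (P? x)
  ... | true  = n≤1+n _
  ... | false = ≤-refl

module _ {a p q} {A : Set a} {P : Pred A p} {Q : Pred A q}
         (P? : Decidable P) (Q? : Decidable Q) (P⇒Q : ∀ {x} → P x → Q x) where

  length-filter-gap-∷ : ∀ {k} y xs →
    k + length (filter P? xs) ≤ length (filter Q? xs) →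
    k + length (filter P? (y ∷ xs)) ≤ length (filter Q? (y ∷ xs))
  length-filter-gap-∷ {k} y xs gap with P? y
  ... | yes py = begin
    k + suc (length (filter P? xs)) ≡⟨ +-suc k _ ⟩
    suc (k + length (filter P? xs)) ≤⟨ s≤s gap ⟩
    suc (length (filter Q? xs))     ≡⟨ length-filter-accept Q? xs (P⇒Q py) ⟨
    length (filter Q? (y ∷ xs))     ∎
    where open ≤-Reasoning
  ... | no _ = ≤-trans gap (length-filter-≤-∷ Q? y xs)

  length-filter-mono : ∀ xs → length (filter P? xs) ≤ length (filter Q? xs)
  length-filter-mono []       = z≤n
  length-filter-mono (x ∷ xs) = length-filter-gap-∷ x xs (length-filter-mono xs)

  length-filter-gain : ∀ {x xs} → x ∈ˡ xs → Q x → ¬ P x →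
                       1 + length (filter P? xs) ≤ length (filter Q? xs)
  length-filter-gain {xs = _ ∷ xs} (here refl) qx ¬px =
    subst₂ _≤_ (cong suc (sym (length-filter-reject P? xs ¬px))) (sym (length-filter-accept Q? xs qx))
      (s≤s (length-filter-mono xs))
  length-filter-gain {xs = y ∷ xs} (there x∈xs) qx ¬px =
    length-filter-gap-∷ y xs (length-filter-gain x∈xs qx ¬px)

  length-filter-gain₂ : ∀ {x y xs} → x ≢ y → x ∈ˡ xs → y ∈ˡ xs →
                        Q x → ¬ P x → Q y → ¬ P y →
                        2 + length (filter P? xs) ≤ length (filter Q? xs)
  length-filter-gain₂ x≢y (here refl) (here refl) _ _ _ _ = contradiction refl x≢y
  length-filter-gain₂ {xs = _ ∷ xs} _ (here refl) (there y∈xs) qx ¬px qy ¬py =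
    subst₂ _≤_ (cong (2 +_) (sym (length-filter-reject P? xs ¬px))) (sym (length-filter-accept Q? xs qx))
      (s≤s (length-filter-gain y∈xs qy ¬py))
  length-filter-gain₂ {xs = _ ∷ xs} _ (there x∈xs) (here refl) qx ¬px qy ¬py =
    subst₂ _≤_ (cong (2 +_) (sym (length-filter-reject P? xs ¬py))) (sym (length-filter-accept Q? xs qy))
      (s≤s (length-filter-gain x∈xs qx ¬px))
  length-filter-gain₂ {xs = z ∷ xs} x≢y (there x∈xs) (there y∈xs) qx ¬px qy ¬py =
    length-filter-gap-∷ z xs (length-filter-gain₂ x≢y x∈xs y∈xs qx ¬px qy ¬py)

module _ {a p q r s} {A : Set a} {P : Pred A p} {Q : Pred A q} {R : Pred A r} {S : Pred A s}
         (P? : Decidable P) (Q? : Decidable Q) (R? : Decidable R) (S? : Decidable S)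
         (P⇒R : ∀ {x} → P x → R x) (Q⇒R : ∀ {x} → Q x → R x)
         (P∧Q⇒S : ∀ {x} → P x → Q x → S x) where

  length-filter-supermodular : ∀ xs →
    length (filter P? xs) + length (filter Q? xs) ≤ length (filter R? xs) + length (filter S? xs)
  length-filter-supermodular []       = z≤n
  length-filter-supermodular (x ∷ xs) with ih ← length-filter-supermodular xs | P? x | Q? x
  ... | yes px | yes qx = begin
    suc (lP + suc lQ)                     ≡⟨ cong suc (+-suc lP lQ) ⟩
    suc (suc (lP + lQ))                   ≤⟨ s≤s (s≤s ih) ⟩
    suc (suc (lR + lS))                   ≡⟨ cong suc (+-suc lR lS) ⟨
    suc lR + suc lS                       ≡⟨ cong₂ _+_ (length-filter-accept R? xs (P⇒R px))
                                                       (length-filter-accept S? xs (P∧Q⇒S px qx)) ⟨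
    length (filter R? (x ∷ xs)) + length (filter S? (x ∷ xs)) ∎
    where
    open ≤-Reasoning
    lP = length (filter P? xs); lQ = length (filter Q? xs)
    lR = length (filter R? xs); lS = length (filter S? xs)
  ... | yes px | no _ =
    ≤-trans (s≤s ih) (+-mono-≤ (≤-reflexive (sym (length-filter-accept R? xs (P⇒R px))))
                               (length-filter-≤-∷ S? x xs))
  ... | no _ | yes qx = ≤-trans (≤-reflexive (+-suc _ _)) $
    ≤-trans (s≤s ih) (+-mono-≤ (≤-reflexive (sym (length-filter-accept R? xs (Q⇒R qx))))
                               (length-filter-≤-∷ S? x xs))
  ... | no _ | no _ = ≤-trans ih (+-mono-≤ (length-filter-≤-∷ R? x xs) (length-filter-≤-∷ S? x xs))

∣p∪q∣+∣p∩q∣≡∣p∣+∣q∣ : ∀ {n} (p q : Subset n) → ∣ p ∪ q ∣ + ∣ p ∩ q ∣ ≡ ∣ p ∣ + ∣ q ∣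
∣p∪q∣+∣p∩q∣≡∣p∣+∣q∣ []            []            = refl
∣p∪q∣+∣p∩q∣≡∣p∣+∣q∣ (inside ∷ p)  (inside ∷ q)  =
  cong suc (trans (+-suc _ _) (trans (cong suc (∣p∪q∣+∣p∩q∣≡∣p∣+∣q∣ p q)) (sym (+-suc _ _))))
∣p∪q∣+∣p∩q∣≡∣p∣+∣q∣ (inside ∷ p)  (outside ∷ q) = cong suc (∣p∪q∣+∣p∩q∣≡∣p∣+∣q∣ p q)
∣p∪q∣+∣p∩q∣≡∣p∣+∣q∣ (outside ∷ p) (inside ∷ q)  =
  trans (cong suc (∣p∪q∣+∣p∩q∣≡∣p∣+∣q∣ p q)) (sym (+-suc _ _))
∣p∪q∣+∣p∩q∣≡∣p∣+∣q∣ (outside ∷ p) (outside ∷ q) = ∣p∪q∣+∣p∩q∣≡∣p∣+∣q∣ p q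

∣p∪q∣≤∣p∣+∣q∣ : ∀ {n} (p q : Subset n) → ∣ p ∪ q ∣ ≤ ∣ p ∣ + ∣ q ∣
∣p∪q∣≤∣p∣+∣q∣ p q = ≤-trans (m≤m+n _ _) (≤-reflexive (∣p∪q∣+∣p∩q∣≡∣p∣+∣q∣ p q))

∣p∪q∣≤∣p∣+i : ∀ {n} (p q : Subset n) {i j} → ∣ q ∣ ≡ i + j → j ≤ ∣ p ∩ q ∣ → ∣ p ∪ q ∣ ≤ ∣ p ∣ + i
∣p∪q∣≤∣p∣+i p q {i} {j} ∣q∣≡i+j j≤∣p∩q∣ = +-cancelʳ-≤ j _ _ $ begin
  ∣ p ∪ q ∣ + j         ≤⟨ +-monoʳ-≤ _ j≤∣p∩q∣ ⟩
  ∣ p ∪ q ∣ + ∣ p ∩ q ∣ ≡⟨ ∣p∪q∣+∣p∩q∣≡∣p∣+∣q∣ p q ⟩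
  ∣ p ∣ + ∣ q ∣         ≡⟨ cong (∣ p ∣ +_) ∣q∣≡i+j ⟩
  ∣ p ∣ + (i + j)       ≡⟨ +-assoc ∣ p ∣ i j ⟨
  ∣ p ∣ + i + j         ∎
  where open ≤-Reasoning

x∈p⇒0<∣p∣ : ∀ {n} {p : Subset n} {x} → x ∈ p → 0 < ∣ p ∣
x∈p⇒0<∣p∣ x∈p = ≤-trans (s≤s z≤n) (x∈p⇒∣p-x∣<∣p∣ x∈p)

x∈p∧y∈p∧x≢y⇒1<∣p∣ : ∀ {n} {p : Subset n} {x y} → x ∈ p → y ∈ p → x ≢ y → 1 < ∣ p ∣
x∈p∧y∈p∧x≢y⇒1<∣p∣ x∈p y∈p x≢y =
  ≤-trans (s≤s (x∈p⇒0<∣p∣ (x∈p∧x≢y⇒x∈p-y y∈p (x≢y ∘ sym)))) (x∈p⇒∣p-x∣<∣p∣ x∈p)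

module _ {n : ℕ} (H : Hypergraph n) where

  private
    [_] : Subset (suc n) → ℕ
    [ X ] = ⟦_⟧ H X

  [∅]≡0 : [ ∅ ] ≡ 0
  [∅]≡0 = cong length (filter-none (_⊆? ∅) (All.map edge⊈∅ (edges-size H)))
    where
    edge⊈∅ : ∀ {e} → ∣ e ∣ ≡ 3 → ¬ e ⊆ ∅
    edge⊈∅ ∣e∣≡3 e⊆∅ = contradiction (subst₂ _≤_ ∣e∣≡3 (∣⊥∣≡0 (suc n)) (p⊆q⇒∣p∣≤∣q∣ e⊆∅)) λ ()

  modest⇒sparse : ∀ {m X} → Modest H m → ∣ X ∣ ≤ 2 * m → 2 * [ X ] ≤ ∣ X ∣
  modest⇒sparse {X = X} modest ∣X∣≤2m with nonempty? X
  ... | yes X≠∅ = ≮⇒≥ (λ superdense → modest X ∣X∣≤2m (X≠∅ , superdense))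
  ... | no X≡∅ rewrite Empty-unique X≡∅ = ≤-trans (≤-reflexive (cong (2 *_) [∅]≡0)) z≤n

  [_]-supermodular : ∀ X Y → [ X ] + [ Y ] ≤ [ X ∪ Y ] + [ X ∩ Y ]
  [ X ]-supermodular Y = length-filter-supermodular (_⊆? X) (_⊆? Y) (_⊆? X ∪ Y) (_⊆? X ∩ Y)
    (λ e⊆X → p⊆p∪q Y ∘ e⊆X) (λ e⊆Y → q⊆p∪q X Y ∘ e⊆Y)
    (λ e⊆X e⊆Y x∈e → x∈p∩q⁺ (e⊆X x∈e , e⊆Y x∈e)) (edges H)

  dense-∪ : ∀ {A B} → 2 * [ A ∩ B ] ≤ ∣ A ∩ B ∣ →
            ∣ A ∣ ≤ 2 * [ A ] → ∣ B ∣ ≤ 2 * [ B ] → ∣ A ∪ B ∣ ≤ 2 * [ A ∪ B ]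
  dense-∪ {A} {B} A∩B-sparse A-dense B-dense = +-cancelʳ-≤ ∣ A ∩ B ∣ _ _ $ begin
    ∣ A ∪ B ∣ + ∣ A ∩ B ∣         ≡⟨ ∣p∪q∣+∣p∩q∣≡∣p∣+∣q∣ A B ⟩
    ∣ A ∣ + ∣ B ∣                 ≤⟨ +-mono-≤ A-dense B-dense ⟩
    2 * [ A ] + 2 * [ B ]         ≡⟨ *-distribˡ-+ 2 [ A ] [ B ] ⟨
    2 * ([ A ] + [ B ])           ≤⟨ *-monoʳ-≤ 2 ([ A ]-supermodular B) ⟩
    2 * ([ A ∪ B ] + [ A ∩ B ])   ≡⟨ *-distribˡ-+ 2 [ A ∪ B ] [ A ∩ B ] ⟩
    2 * [ A ∪ B ] + 2 * [ A ∩ B ] ≤⟨ +-monoʳ-≤ _ A∩B-sparse ⟩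
    2 * [ A ∪ B ] + ∣ A ∩ B ∣     ∎
    where open ≤-Reasoning

  superdense-extension : ∀ {D T i k} → ∣ D ∣ ≤ 2 * [ D ] → k + [ D ] ≤ [ T ] →
                         ∣ T ∣ ≤ ∣ D ∣ + i → i < 2 * k → ∣ T ∣ < 2 * [ T ]
  superdense-extension {D} {T} {i} {k} D-dense gain ∣T∣≤ i<2k = begin-strict
    ∣ T ∣             ≤⟨ ∣T∣≤ ⟩
    ∣ D ∣ + i         <⟨ +-monoʳ-< ∣ D ∣ i<2k ⟩
    ∣ D ∣ + 2 * k     ≤⟨ +-monoˡ-≤ (2 * k) D-dense ⟩
    2 * [ D ] + 2 * k ≡⟨ +-comm (2 * [ D ]) (2 * k) ⟩
    2 * k + 2 * [ D ] ≡⟨ *-distribˡ-+ 2 k [ D ] ⟨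
    2 * (k + [ D ])   ≤⟨ *-monoʳ-≤ 2 gain ⟩
    2 * [ T ]         ∎
    where open ≤-Reasoning

  module _ (l : ℕ) (modest : Modest H (2 * l + 2)) where

    red-blocks-∪-dense : ∀ {A B} → RedBlock H l A → RedBlock H l B → ∣ A ∪ B ∣ ≤ 2 * [ A ∪ B ]
    red-blocks-∪-dense {A} {B} (((_ , A-dense) , _) , ∣A∣≤2l) (((_ , B-dense) , _) , _) =
      dense-∪ (modest⇒sparse {2 * l + 2} modest ∣A∩B∣≤2[2l+2]) A-dense B-dense
      where
      l≤2l+2 : l ≤ 2 * l + 2
      l≤2l+2 = ≤-trans (m≤n*m l 2) (m≤m+n (2 * l) 2)
      ∣A∩B∣≤2[2l+2] : ∣ A ∩ B ∣ ≤ 2 * (2 * l + 2)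
      ∣A∩B∣≤2[2l+2] = ≤-trans (∣p∩q∣≤∣p∣ A B) (≤-trans ∣A∣≤2l (*-monoʳ-≤ 2 l≤2l+2))

    red-blocks-∪-small : ∀ {A B} → RedBlock H l A → RedBlock H l B → ∣ A ∪ B ∣ ≤ 2 * l + 2 * l
    red-blocks-∪-small {A} {B} (_ , ∣A∣≤2l) (_ , ∣B∣≤2l) =
      ≤-trans (∣p∪q∣≤∣p∣+∣q∣ A B) (+-mono-≤ ∣A∣≤2l ∣B∣≤2l)

    no-superdense-extension : ∀ {D T x i k} → ∣ D ∣ ≤ 2 * [ D ] → ∣ D ∣ ≤ 2 * l + 2 * l → x ∈ T →
                              ∣ T ∣ ≤ ∣ D ∣ + i → i ≤ 4 → i < 2 * k → k + [ D ] ≤ [ T ] → ⊥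
    no-superdense-extension {D} {T} {x} {i} D-dense ∣D∣≤4l x∈T ∣T∣≤ i≤4 i<2k gain =
      modest T ∣T∣≤2[2l+2] ((x , x∈T) , superdense-extension D-dense gain ∣T∣≤ i<2k)
      where
      ∣T∣≤2[2l+2] : ∣ T ∣ ≤ 2 * (2 * l + 2)
      ∣T∣≤2[2l+2] = begin
        ∣ T ∣                 ≤⟨ ∣T∣≤ ⟩
        ∣ D ∣ + i             ≤⟨ +-mono-≤ ∣D∣≤4l i≤4 ⟩
        2 * l + 2 * l + 4     ≡⟨ 4l+4≡2[2l+2] l ⟩
        2 * (2 * l + 2)       ∎
        where
        open ≤-Reasoning
        4l+4≡2[2l+2] : ∀ l → 2 * l + 2 * l + 4 ≡ 2 * (2 * l + 2)
        4l+4≡2[2l+2] = solve-∀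

    module _ {D} (D-dense : ∣ D ∣ ≤ 2 * [ D ]) (∣D∣≤4l : ∣ D ∣ ≤ 2 * l + 2 * l) {g} (g∉D : g ∉ D) where

      private
        edge⊈D : ∀ {e} → g ∈ e → ¬ e ⊆ D
        edge⊈D g∈e e⊆D = g∉D (e⊆D g∈e)

      no-edge-through-two : ∀ {e x y} → e ∈ˡ edges H → g ∈ e →
                            x ∈ e → x ∈ D → y ∈ e → y ∈ D → x ≢ y → ⊥
      no-edge-through-two {e} e∈E g∈e x∈e x∈D y∈e y∈D x≢y =
        no-superdense-extension {i = 1} {k = 1} D-dense ∣D∣≤4l (q⊆p∪q D e g∈e) ∣D∪e∣≤∣D∣+1
          (s≤s z≤n) (s≤s (s≤s z≤n))
          (length-filter-gain (_⊆? D) (_⊆? D ∪ e) (p⊆p∪q e ∘_) e∈E (q⊆p∪q D e) (edge⊈D g∈e))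
        where
        ∣D∪e∣≤∣D∣+1 : ∣ D ∪ e ∣ ≤ ∣ D ∣ + 1
        ∣D∪e∣≤∣D∣+1 = ∣p∪q∣≤∣p∣+i D e (All.lookup (edges-size H) e∈E)
          (x∈p∧y∈p∧x≢y⇒1<∣p∣ (x∈p∩q⁺ (x∈D , x∈e)) (x∈p∩q⁺ (y∈D , y∈e)) x≢y)

      no-two-edges : ∀ {e₁ e₂ x y} → e₁ ∈ˡ edges H → e₂ ∈ˡ edges H → e₁ ≢ e₂ → g ∈ e₁ → g ∈ e₂ →
                     x ∈ e₁ → x ∈ D → y ∈ e₂ → y ∈ D → g ≢ y → ⊥
      no-two-edges {e₁} {e₂} e₁∈E e₂∈E e₁≢e₂ g∈e₁ g∈e₂ x∈e₁ x∈D y∈e₂ y∈D g≢y =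
        no-superdense-extension {i = 3} {k = 2} D-dense ∣D∣≤4l (e₂⊆T g∈e₂) ∣T∣≤∣D∣+3
          (s≤s (s≤s (s≤s z≤n))) (s≤s (s≤s (s≤s (s≤s z≤n))))
          (length-filter-gain₂ (_⊆? D) (_⊆? T) (D⊆T ∘_) e₁≢e₂ e₁∈E e₂∈E
            e₁⊆T (edge⊈D g∈e₁) e₂⊆T (edge⊈D g∈e₂))
        where
        T = (D ∪ e₁) ∪ e₂
        D⊆T : D ⊆ T
        D⊆T = ⊆-trans (p⊆p∪q e₁) (p⊆p∪q e₂)
        e₁⊆T : e₁ ⊆ T
        e₁⊆T = ⊆-trans (q⊆p∪q D e₁) (p⊆p∪q e₂)
        e₂⊆T : e₂ ⊆ T
        e₂⊆T = q⊆p∪q (D ∪ e₁) e₂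
        ∣D∪e₁∣≤∣D∣+2 : ∣ D ∪ e₁ ∣ ≤ ∣ D ∣ + 2
        ∣D∪e₁∣≤∣D∣+2 = ∣p∪q∣≤∣p∣+i D e₁ (All.lookup (edges-size H) e₁∈E)
          (x∈p⇒0<∣p∣ (x∈p∩q⁺ (x∈D , x∈e₁)))
        ∣T∣≤∣D∪e₁∣+1 : ∣ T ∣ ≤ ∣ D ∪ e₁ ∣ + 1
        ∣T∣≤∣D∪e₁∣+1 = ∣p∪q∣≤∣p∣+i (D ∪ e₁) e₂ (All.lookup (edges-size H) e₂∈E)
          (x∈p∧y∈p∧x≢y⇒1<∣p∣ (x∈p∩q⁺ (q⊆p∪q D e₁ g∈e₁ , g∈e₂))
                             (x∈p∩q⁺ (p⊆p∪q e₁ y∈D , y∈e₂)) g≢y)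
        ∣T∣≤∣D∣+3 : ∣ T ∣ ≤ ∣ D ∣ + 3
        ∣T∣≤∣D∣+3 = ≤-trans ∣T∣≤∣D∪e₁∣+1 $
          ≤-trans (+-monoˡ-≤ 1 ∣D∪e₁∣≤∣D∣+2) (≤-reflexive (+-assoc ∣ D ∣ 2 1))

      not-adjacent-to-two : ∀ {x y} → x ∈ D → y ∈ D → x ≢ y → g ≢ y →
                            Adjacent H g x → Adjacent H g y → ⊥
      not-adjacent-to-two x∈D y∈D x≢y g≢y g~x g~y
        with e₁ , e₁∈E , g∈e₁ , x∈e₁ ← find g~x
           | e₂ , e₂∈E , g∈e₂ , y∈e₂ ← find g~y
        with ≡-dec _≟_ e₁ e₂
      ... | yes refl = no-edge-through-two e₁∈E g∈e₁ x∈e₁ x∈D y∈e₂ y∈D x≢y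
      ... | no e₁≢e₂ = no-two-edges e₁∈E e₂∈E e₁≢e₂ g∈e₁ g∈e₂ x∈e₁ x∈D y∈e₂ y∈D g≢y

lemma2p3p3 : (l : ℕ) → 2 ≤ l → {n : ℕ} → (H : Hypergraph n) → Modest H (2 * l + 2) →
    (g r₁ r₂ : Fin _) → Green H l g → Red H l r₁ → Red H l r₂ → r₁ ≢ r₂ →
    ¬ (Adjacent H g r₁ × Adjacent H g r₂)
lemma2p3p3 l _ H modest g r₁ r₂ green (A , A-red , r₁∈A) (B , B-red , r₂∈B) r₁≢r₂ (g~r₁ , g~r₂) =
  not-adjacent-to-two H l modest (red-blocks-∪-dense H l modest A-red B-red)
    (red-blocks-∪-small H l modest A-red B-red) g∉A∪B
    (p⊆p∪q B r₁∈A) (q⊆p∪q A B r₂∈B) r₁≢r₂ g≢r₂ g~r₁ g~r₂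
  where
  g∉A∪B : g ∉ A ∪ B
  g∉A∪B = [ (λ g∈A → green (A , A-red , g∈A)) , (λ g∈B → green (B , B-red , g∈B)) ]′ ∘ x∈p∪q⁻ A B
  g≢r₂ : g ≢ r₂
  g≢r₂ refl = green (B , B-red , r₂∈B)
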